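{- For every term rewriting system $\mathcal{R}$, each of the relations $\twoheadrightarrow^{\infty}$, $\stackrel{\infty}{\to}$ and $\stackrel{\infty}{=}$ on $T$ is reflexive and transitive, and $\stackrel{\infty}{=}$ is moreover symmetric.
   Context: Fix a signature $\Sigma$ and an infinite set $\mathcal{X}$ of variables disjoint from $\Sigma$; $T$ is the set of finite and infinite terms over $\Sigma$ and $\mathcal{X}$. A term rewriting system $\mathcal{R}$ is a set of rules $\ell\to r$ with $\ell,r\in T$, $\ell\notin\mathcal{X}$, variables of $r$ occurring in $\ell$. Root steps: $\to_\varepsilon=\{(\ell\sigma,r\sigma)\mid\ell\to r\in\mathcal{R},\ \sigma:\mathcal{X}\to T\}$, and $\leftarrow_\varepsilon$ its inverse. For $R\subseteq T\times T$, $\underline{R}=\{(f(s_1,\dots,s_n),f(t_1,\dots,t_n))\mid f\in\Sigma,\ \mathrm{ar}(f)=n,\ s_iRt_i\}\cup\mathrm{id}$ with $\mathrm{id}$ the identity on $T$; $;$ is diagrammatic composition, $^*$ reflexive-transitive closure, $\mu,\nu$ least/greatest fixed points on the lattice of relations on $T$. Define infinitary rewriting $\twoheadrightarrow^{\infty}=\mu R.\,\nu S.\,(\to_\varepsilon\cup\underline{R})^*;\underline{S}$, bi-infinite rewriting $\stackrel{\infty}{\to}=\nu R.\,(\to_\varepsilon\cup\underline{R})^*$, infinitary equational reasoning $\stackrel{\infty}{=}=\nu R.\,(\leftarrow_\varepsilon\cup\to_\varepsilon\cup\underline{R})^*$. -}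

module Defs where

open import Level using (Level; _⊔_) renaming (suc to lsuc; zero to lzero)
open import Data.Nat using (ℕ; _<_)
open import Data.Fin using (Fin; toℕ)
open import Data.List using (List; []; _∷_; _++_; [_])
open import Data.Maybe using (Maybe; just; nothing; Is-just)
open import Data.Product using (Σ; Σ-syntax; ∃-syntax; _×_; _,_)
open import Data.Sum using (_⊎_; inj₁; inj₂)
open import Relation.Nullary using (¬_)
open import Relation.Binary.Core using (Rel)
open import Relation.Binary.PropositionalEquality using (_≡_)
open import Relation.Binary.Construct.Closure.ReflexiveTransitive using (Star)

_∪_ : {A : Set} {ℓ₁ ℓ₂ : Level} → Rel A ℓ₁ → Rel A ℓ₂ → Rel A (ℓ₁ ⊔ ℓ₂)
(R ∪ S) a b = R a b ⊎ S a b

_⁻¹ : {A : Set} {ℓ : Level} → Rel A ℓ → Rel A ℓ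
(R ⁻¹) a b = R b a

_⨾_ : {A : Set} {ℓ₁ ℓ₂ : Level} → Rel A ℓ₁ → Rel A ℓ₂ → Rel A (ℓ₁ ⊔ ℓ₂)
(R ⨾ S) a c = ∃[ b ] (R a b × S b c)

-- Greatest fixed point on the lattice of relations on A (relations
-- A → A → Set): the union of all post-fixed points (Knaster–Tarski).
νRel : {A : Set} {ℓ : Level} → (Rel A lzero → Rel A ℓ) → Rel A (lsuc lzero ⊔ ℓ)
νRel {A} F a b = Σ[ S ∈ Rel A lzero ] ((∀ {x y} → S x y → F S x y) × S a b)

-- Finite and infinite terms over a signature (F, ar) and variables X,
-- represented as labelled trees: a partial labelling of positions
-- (finite sequences of argument indices) with symbols, such that the
-- root is labelled and a position p·i is labelled iff p is labelled by
-- a symbol of arity > i (variables have arity 0).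

module Terms (F : Set) (ar : F → ℕ) (X : Set) where

  Sym : Set
  Sym = F ⊎ X

  arity : Sym → ℕ
  arity (inj₁ f) = ar f
  arity (inj₂ x) = 0

  Pos : Set
  Pos = List ℕ

  record Term : Set where
    field
      lab       : Pos → Maybe Sym
      root-def  : Is-just (lab [])
      child-def : ∀ p i → Is-just (lab (p ++ [ i ])) →
                  Σ[ g ∈ Sym ] (lab p ≡ just g × i < arity g)
      def-child : ∀ p i (g : Sym) → lab p ≡ just g → i < arity g →
                  Is-just (lab (p ++ [ i ]))

  open Term public

  _≈_ : Term → Term → Set
  s ≈ t = ∀ p → lab s p ≡ lab t p

  sub : (s : Term) {f : F} → lab s [] ≡ just (inj₁ f) → Fin (ar f) → Term
  lab (sub s eq i) p = lab s (toℕ i ∷ p)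
  root-def (sub s {f} eq i) =
    def-child s [] (toℕ i) (inj₁ f) eq (Data.Fin.Properties.toℕ<n i)
    where import Data.Fin.Properties
  child-def (sub s eq i) p j = child-def s (toℕ i ∷ p) j
  def-child (sub s eq i) p j = def-child s (toℕ i ∷ p) j

  substLab : (Pos → Maybe Sym) → (X → Term) → Pos → Maybe Sym
  substLab l σ p with l []
  ... | just (inj₂ x) = lab (σ x) p
  ... | just (inj₁ f) = go p
    where
      go : Pos → Maybe Sym
      go [] = just (inj₁ f)
      go (i ∷ q) = substLab (λ r → l (i ∷ r)) σ q
  ... | nothing = nothing

  IsInstance : Term → (X → Term) → Term → Set
  IsInstance t σ s = ∀ p → lab s p ≡ substLab (lab t) σ p

  Occurs : X → Term → Set
  Occurs x t = Σ[ p ∈ Pos ] (lab t p ≡ just (inj₂ x))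

  record IsTRS (ℛ : Rel Term lzero) : Set where
    field
      lhs-not-var  : ∀ {ℓ r} → ℛ ℓ r → ∀ x → ¬ (lab ℓ [] ≡ just (inj₂ x))
      vars-rhs⊆lhs : ∀ {ℓ r} → ℛ ℓ r → ∀ x → Occurs x r → Occurs x ℓ

  Lift : {ℓ : Level} → Rel Term ℓ → Rel Term ℓ
  Lift R s t =
    (s ≈ t) ⊎
    (Σ[ f ∈ F ] Σ[ es ∈ lab s [] ≡ just (inj₁ f) ] Σ[ et ∈ lab t [] ≡ just (inj₁ f) ]
       (∀ i → R (sub s es i) (sub t et i)))

  module _ (ℛ : Rel Term lzero) where

    RootStep : Rel Term lzero
    RootStep s t = Σ[ ℓ ∈ Term ] Σ[ r ∈ Term ] Σ[ σ ∈ (X → Term) ]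
                   (ℛ ℓ r × IsInstance ℓ σ s × IsInstance r σ t)

    -- infinitary rewriting  ↠∞ = μR. νS. (→ε ∪ R̲)* ; S̲
    -- (μ as an inductive type, ν as νRel)
    data InfRew (s t : Term) : Set₁ where
      fold : νRel (λ S → Star (RootStep ∪ Lift InfRew) ⨾ Lift S) s t → InfRew s t

    BiInfRew : Rel Term (lsuc lzero)
    BiInfRew = νRel (λ R → Star (RootStep ∪ Lift R))

    InfEq : Rel Term (lsuc lzero)
    InfEq = νRel (λ R → Star ((RootStep ⁻¹) ∪ (RootStep ∪ Lift R)))

-- A greatest fixed point is the union of all post-fixed points, so each
-- property amounts to exhibiting a suitable post-fixed point. For
-- ν R. (G R)* with G monotone, the identity is one (reflexivity), the
-- reflexive-transitive closure of the union of two is one (transitivity),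
-- and, when G commutes with converse, the converse of one is one
-- (symmetry). For ↠∞ = μ R. ν S. (→ε ∪ R̲)* ; S̲, composing a ↠∞ b with
-- b ↠∞ c only adds the pair (a, c) to the post-fixed point witnessing
-- b ↠∞ c, because the outer μ lets all of a ↠∞ b be absorbed into the
-- finite prefix (→ε ∪ R̲)*.
module Submission where

open import Defs
open import Data.Nat using (ℕ)
open import Data.Product using (_×_; _,_)
open import Data.Sum using (_⊎_; inj₁; inj₂; map₂)
open import Function using (_∘_)
open import Function.Bundles using (_↣_)
open import Level using (0ℓ; suc)
open import Relation.Binary.Core using (Rel; _⇒_)
open import Relation.Binary.Definitions using (Reflexive; Transitive; Symmetric)
open import Relation.Binary.PropositionalEquality using (_≡_; refl; sym)
open import Relation.Binary.Construct.Closure.ReflexiveTransitive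
  using (Star; ε; _◅◅_; map; return; reverse; _⋆)

module _ {A : Set} (G : Rel A 0ℓ → Rel A 0ℓ) where

  νStar : Rel A (suc 0ℓ)
  νStar = νRel (λ R → Star (G R))

  νStar-refl : Reflexive νStar
  νStar-refl = _≡_ , (λ { refl → ε }) , refl

  νStar-trans : (∀ {R S} → R ⇒ S → G R ⇒ G S) → Transitive νStar
  νStar-trans G-mono (S₁ , post₁ , s₁) (S₂ , post₂ , s₂) =
    U , (unfold ⋆) , return (inj₁ s₁) ◅◅ return (inj₂ s₂)
    where
      U : Rel A 0ℓ
      U = Star (S₁ ∪ S₂)

      unfold : S₁ ∪ S₂ ⇒ Star (G U)
      unfold (inj₁ s) = map (G-mono (return ∘ inj₁)) (post₁ s)
      unfold (inj₂ s) = map (G-mono (return ∘ inj₂)) (post₂ s)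

  νStar-sym : (∀ {R x y} → G R x y → G (R ⁻¹) y x) → Symmetric νStar
  νStar-sym G-flip (S , post , s) = S ⁻¹ , (λ t → reverse G-flip (post t)) , s

module _ (F : Set) (ar : F → ℕ) (X : Set) where
  open Terms F ar X

  -- Lift unfolds to a sum, so Agda cannot recover R, s and t from the type of
  -- a Lift R s t; callers below therefore pass them explicitly.
  Lift-mono : ∀ {ℓ₁ ℓ₂} {R : Rel Term ℓ₁} {S : Rel Term ℓ₂} → R ⇒ S → Lift R ⇒ Lift S
  Lift-mono R⇒S (inj₁ s≈t) = inj₁ s≈t
  Lift-mono R⇒S {s} {t} (inj₂ (f , es , et , R-args)) =
    inj₂ (f , es , et , λ i → R⇒S {sub s es i} {sub t et i} (R-args i))

  Lift-flip : ∀ {R : Rel Term 0ℓ} {s t} → Lift R s t → Lift (R ⁻¹) t s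
  Lift-flip (inj₁ s≈t) = inj₁ (sym ∘ s≈t)
  Lift-flip (inj₂ (f , es , et , R-args)) = inj₂ (f , et , es , R-args)

  module _ (ℛ : Rel Term 0ℓ) where

    InfRewPrefix : Rel Term (suc 0ℓ)
    InfRewPrefix = Star (RootStep ℛ ∪ Lift (InfRew ℛ))

    InfRew-refl : Reflexive (InfRew ℛ)
    InfRew-refl = fold (_≈_ , (λ s≈t → _ , ε , inj₁ s≈t) , λ _ → refl)

    InfRew-prepend : ∀ {a b c} → InfRewPrefix a b → InfRew ℛ b c → InfRew ℛ a c
    InfRew-prepend {a} {c = c} a↠b (fold (S , post , b-S-c)) =
      fold (S′ , post′ , inj₂ (refl , refl))
      where
        S′ : Rel Term 0ℓ
        S′ x y = S x y ⊎ (x ≡ a × y ≡ c)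

        post′ : ∀ {x y} → S′ x y → (InfRewPrefix ⨾ Lift S′) x y
        post′ {y = y} (inj₁ x-S-y) with post x-S-y
        ... | m , x↠m , m-S-y = m , x↠m , Lift-mono {R = S} {S = S′} inj₁ {m} {y} m-S-y
        post′ (inj₂ (refl , refl)) with post b-S-c
        ... | m , b↠m , m-S-c = m , a↠b ◅◅ b↠m , Lift-mono {R = S} {S = S′} inj₁ {m} {c} m-S-c

    InfRew-trans : Transitive (InfRew ℛ)
    InfRew-trans {j = b} (fold (S , post , a-S-b)) b↠c with post a-S-b
    ... | m , a↠m , m-S-b = InfRew-prepend (a↠m ◅◅ return (inj₂ m-InfRew-b)) b↠c
      where
        m-InfRew-b : Lift (InfRew ℛ) m b
        m-InfRew-b = Lift-mono {R = S} (λ t → fold (S , post , t)) {m} {b} m-S-b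

    RewStep : Rel Term 0ℓ → Rel Term 0ℓ
    RewStep R = RootStep ℛ ∪ Lift R

    EqStep : Rel Term 0ℓ → Rel Term 0ℓ
    EqStep R = (RootStep ℛ ⁻¹) ∪ RewStep R

    RewStep-mono : ∀ {R S} → R ⇒ S → RewStep R ⇒ RewStep S
    RewStep-mono {R} {S} R⇒S {x} {y} = map₂ (Lift-mono {R = R} {S = S} R⇒S {x} {y})

    EqStep-mono : ∀ {R S} → R ⇒ S → EqStep R ⇒ EqStep S
    EqStep-mono {R} {S} R⇒S {x} {y} = map₂ (RewStep-mono {R} {S} R⇒S {x} {y})

    EqStep-flip : ∀ {R x y} → EqStep R x y → EqStep (R ⁻¹) y x
    EqStep-flip (inj₁ backward)       = inj₂ (inj₁ backward)
    EqStep-flip (inj₂ (inj₁ forward)) = inj₁ forward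
    EqStep-flip {R} {x} {y} (inj₂ (inj₂ lifted)) =
      inj₂ (inj₂ (Lift-flip {R} {x} {y} lifted))

    BiInfRew-refl : Reflexive (BiInfRew ℛ)
    BiInfRew-refl = νStar-refl RewStep

    BiInfRew-trans : Transitive (BiInfRew ℛ)
    BiInfRew-trans = νStar-trans RewStep RewStep-mono

    InfEq-refl : Reflexive (InfEq ℛ)
    InfEq-refl = νStar-refl EqStep

    InfEq-trans : Transitive (InfEq ℛ)
    InfEq-trans = νStar-trans EqStep EqStep-mono

    InfEq-sym : Symmetric (InfEq ℛ)
    InfEq-sym = νStar-sym EqStep (λ {R} {x} {y} → EqStep-flip {R} {x} {y})

lemma7p1 : (F : Set) (ar : F → ℕ) (X : Set) → (ℕ ↣ X) →
    (ℛ : Rel (Terms.Term F ar X) 0ℓ) → Terms.IsTRS F ar X ℛ →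
    (Reflexive (Terms.InfRew F ar X ℛ) × Transitive (Terms.InfRew F ar X ℛ))
    × (Reflexive (Terms.BiInfRew F ar X ℛ) × Transitive (Terms.BiInfRew F ar X ℛ))
    × (Reflexive (Terms.InfEq F ar X ℛ) × Transitive (Terms.InfEq F ar X ℛ)
       × Symmetric (Terms.InfEq F ar X ℛ))
lemma7p1 F ar X _ ℛ _ =
    (InfRew-refl F ar X ℛ , InfRew-trans F ar X ℛ)
  , (BiInfRew-refl F ar X ℛ , BiInfRew-trans F ar X ℛ)
  , (InfEq-refl F ar X ℛ , InfEq-trans F ar X ℛ , InfEq-sym F ar X ℛ)
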